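{- Fix an integer $t\ge 2$. There exists a constant $C_t>0$ such that for all $n\ge 1$ and all simple $K_{2,t}$-free graphs $G$ on $n$ vertices, \[ \tau(G)\le \frac{1}{n^2}\Bigl(1+C_t\sqrt{n}\Bigr)^{n}. \] Consequently, \[ \log \mathrm{st}(n,K_{2,t}) \le \frac{n}{2}\log n + O_t(n). \]
   Context: For a graph $G$, $\tau(G)$ denotes its number of spanning trees (which is $0$ if $G$ is disconnected). A graph is $H$-free if it contains no subgraph isomorphic to $H$. For a graph $H$ and $n\in\mathbb N$, $\mathrm{st}(n,H)$ is the maximum of $\tau(G)$ over all simple, connected, $H$-free graphs $G$ on $n$ vertices. $K_{2,t}$ is the complete bipartite graph with parts of sizes $2$ and $t$. -}

module Defs where

open import Data.Nat using (ℕ; zero; suc; _+_; _*_; _∸_; _≤_; _<ᵇ_; _≡ᵇ_)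
open import Data.Bool using (Bool; true; false; _∧_; _∨_; not; if_then_else_)
open import Data.Fin using (Fin; toℕ)
open import Data.List using (List; []; _∷_; _++_; map; concatMap; length; filterᵇ; upTo; allFin)
open import Data.Product using (_×_; _,_; Σ)
open import Data.Sum using (_⊎_)
open import Relation.Binary.PropositionalEquality using (_≡_; _≢_)
open import Relation.Nullary using (¬_)
open import Function.Definitions using (Injective)

record Graph (n : ℕ) : Set where
  field
    adj    : Fin n → Fin n → Bool
    sym    : ∀ i j → adj i j ≡ adj j i
    irrefl : ∀ i → adj i i ≡ false
open Graph public

anyL : {A : Set} → (A → Bool) → List A → Bool
anyL p []       = false
anyL p (x ∷ xs) = p x ∨ anyL p xs

allL : {A : Set} → (A → Bool) → List A → Bool
allL p []       = true
allL p (x ∷ xs) = p x ∧ allL p xs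

eqF : {n : ℕ} → Fin n → Fin n → Bool
eqF i j = toℕ i ≡ᵇ toℕ j

allLists : (n k : ℕ) → List (List (Fin n))
allLists n zero    = [] ∷ []
allLists n (suc k) = concatMap (λ xs → map (λ v → v ∷ xs) (allFin n)) (allLists n k)

walkOK : {n : ℕ} → (Fin n → Fin n → Bool) → Fin n → List (Fin n) → Bool
walkOK a u []       = true
walkOK a u (v ∷ vs) = a u v ∧ walkOK a v vs

lastV : {n : ℕ} → Fin n → List (Fin n) → Fin n
lastV u []       = u
lastV u (v ∷ vs) = lastV v vs

-- connected: any two vertices are joined by a walk (with at most n-1 steps,
-- which is no restriction since a path has at most n vertices)
connectedB : (n : ℕ) → (Fin n → Fin n → Bool) → Bool
connectedB n a =
  allL (λ u → allL (λ v →
    anyL (λ k → anyL (λ vs → walkOK a u vs ∧ eqF (lastV u vs) v) (allLists n k)) (upTo n))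
    (allFin n)) (allFin n)

distinctB : {n : ℕ} → List (Fin n) → Bool
distinctB []       = true
distinctB (x ∷ xs) = not (anyL (eqF x) xs) ∧ distinctB xs

isCycle : {n : ℕ} → (Fin n → Fin n → Bool) → List (Fin n) → Bool
isCycle a []       = false
isCycle a (v ∷ vs) = distinctB (v ∷ vs) ∧ walkOK a v vs ∧ a (lastV v vs) v

hasCycleB : (n : ℕ) → (Fin n → Fin n → Bool) → Bool
hasCycleB n a = anyL (λ k → (2 <ᵇ k) ∧ anyL (isCycle a) (allLists n k)) (upTo (suc n))

edges : {n : ℕ} → Graph n → List (Fin n × Fin n)
edges {n} G = concatMap (λ i → concatMap (λ j →
  if (toℕ i <ᵇ toℕ j) ∧ adj G i j then (i , j) ∷ [] else []) (allFin n)) (allFin n)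

edgeAdj : {n : ℕ} → List (Fin n × Fin n) → Fin n → Fin n → Bool
edgeAdj T u v = anyL (λ { (a , b) → (eqF a u ∧ eqF b v) ∨ (eqF a v ∧ eqF b u) }) T

subsets : {A : Set} → List A → List (List A)
subsets []       = [] ∷ []
subsets (x ∷ xs) = map (x ∷_) (subsets xs) ++ subsets xs

isSpanningTree : (n : ℕ) → List (Fin n × Fin n) → Bool
isSpanningTree n T = connectedB n (edgeAdj T) ∧ not (hasCycleB n (edgeAdj T))

τ : {n : ℕ} → Graph n → ℕ
τ {n} G = length (filterᵇ (isSpanningTree n) (subsets (edges G)))

Connected : {n : ℕ} → Graph n → Set
Connected {n} G = connectedB n (adj G) ≡ true

-- G contains a (not necessarily induced) copy of K_{2,t}
ContainsK2 : (t : ℕ) → {n : ℕ} → Graph n → Set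
ContainsK2 t {n} G =
  Σ (Fin n) λ a → Σ (Fin n) λ b → Σ (Fin t → Fin n) λ f →
    a ≢ b × Injective _≡_ _≡_ f ×
    (∀ i → f i ≢ a × f i ≢ b × adj G a (f i) ≡ true × adj G b (f i) ≡ true)

K2Free : (t : ℕ) → {n : ℕ} → Graph n → Set
K2Free t G = ¬ ContainsK2 t G

-- Exact arithmetic in ℕ[√m]: a pair (a , b) stands for a + b·√m.
mulS : ℕ → ℕ × ℕ → ℕ × ℕ → ℕ × ℕ
mulS m (a , b) (c , d) = (a * c + b * d * m , a * d + b * c)

powS : ℕ → ℕ × ℕ → ℕ → ℕ × ℕ
powS m x zero    = (1 , 0)
powS m x (suc k) = mulS m x (powS m x k)

-- x ≤ a + b·√m  (exact, for x a, b, m natural)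
_≤[√_]_ : ℕ → ℕ → ℕ × ℕ → Set
x ≤[√ m ] (a , b) = x ≤ a ⊎ (x ∸ a) * (x ∸ a) ≤ b * b * m

-- A spanning tree is an acyclic edge set, hence has at most n edges: a nonempty vertex set in
-- which every vertex has two neighbours inside the set carries a non-backtracking walk, whose
-- first repeated vertex closes a cycle, so an acyclic graph can be peeled vertex by vertex,
-- losing at most one edge each time.  Therefore τ(G) is at most the number of edge sets of
-- size at most n, which is ≤ (e + n)ⁿ / n! ≤ 4ⁿ (e + n)ⁿ / nⁿ for a graph with e edges.
-- Without K₂,ₜ two distinct vertices have fewer than t common neighbours, so double counting
-- paths of length two gives Σ deg² ≤ n² (1 + t), and Cauchy–Schwarz gives e² ≤ n³ (1 + t).
-- Hence τ(G)² ≤ (16 (2t + 4))ⁿ nⁿ.  For the first bound, write (1 + C√n)ᵏ = aₖ + bₖ√n; two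
-- steps of the recursion multiply bₖ by at least C²n, so bₙ² n ≥ (C²n)ᴺ for the largest odd
-- N ≤ n, which dominates n⁴ τ(G)² once C is a large multiple of 16 (2t + 4).

module Submission where

open import Defs hiding (sym)
open import Data.Bool using (Bool; true; false; _∧_; _∨_; not; if_then_else_)
open import Data.Bool.Properties using (∧-identityʳ; ∧-zeroʳ; ∨-zeroʳ; ∨-comm; ∨-idem; not-injective; ¬-not; T-≡)
import Data.Bool as Bool
open import Data.Empty using (⊥-elim)
open import Data.Fin using (Fin; zero; suc; toℕ; fromℕ<)
import Data.Fin as Fin
import Data.Fin.Properties as Fin
open import Data.List using (List; []; _∷_; _++_; map; length; filterᵇ; concatMap; tabulate; allFin)
open import Data.List.Properties using (length-++; filter-++)
open import Data.List.Membership.Propositional using (_∈_)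
open import Data.List.Membership.Propositional.Properties using (∈-upTo⁺; ∈-allFin; ∈-concatMap⁺; ∈-map⁺; ∈-map⁻; ∈-++⁻)
open import Data.List.Relation.Unary.Any using (here; there)
import Data.List.Relation.Unary.Any as Any
open import Data.List.Relation.Binary.Sublist.Propositional using (_⊆_; []; _∷_; _∷ʳ_)
open import Data.List.Relation.Binary.Sublist.Propositional.Properties using (length-mono-≤; filter⁺; ∷ˡ⁻)
open import Data.Nat
open import Data.Nat.Properties
open import Data.Nat.Tactic.RingSolver using (solve-∀)
open import Data.Product using (Σ; Σ-syntax; _×_; _,_; proj₁; proj₂)
open import Data.Sum using (_⊎_; inj₁; inj₂; [_,_]′)
open import Function using (id; _∘_; case_of_)
open import Function.Bundles using (Equivalence)
open import Function.Definitions using (Injective)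
open import Relation.Binary.PropositionalEquality
  using (_≡_; _≢_; refl; sym; trans; cong; cong₂; subst; subst₂; module ≡-Reasoning)
open import Relation.Nullary using (¬_; Dec; yes; no)
open import Relation.Nullary.Decidable using (T?; _×-dec_)
open import Algebra.Properties.CommutativeSemigroup *-commutativeSemigroup using (x∙yz≈y∙xz; xy∙z≈y∙xz)
open import Algebra.Properties.Semiring.Sum +-*-semiring
  using (sum-syntax; sum-cong-≗; ∑-distrib-+; ∑-comm; *-distribˡ-sum; *-distribʳ-sum)

𝟙 : Bool → ℕ
𝟙 true  = 1
𝟙 false = 0

𝟙≤1 : ∀ b → 𝟙 b ≤ 1
𝟙≤1 true  = ≤-refl
𝟙≤1 false = z≤n

𝟙-∧ : ∀ x y → 𝟙 (x ∧ y) ≡ 𝟙 x * 𝟙 y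
𝟙-∧ true  y = sym (+-identityʳ (𝟙 y))
𝟙-∧ false y = refl

𝟙-∧-≤ʳ : ∀ x y → 𝟙 (x ∧ y) ≤ 𝟙 y
𝟙-∧-≤ʳ true  y = ≤-refl
𝟙-∧-≤ʳ false y = z≤n

𝟙-mono : ∀ {x y} → (x ≡ true → y ≡ true) → 𝟙 x ≤ 𝟙 y
𝟙-mono {false}         _   = z≤n
𝟙-mono {true}  {true}  _   = ≤-refl
𝟙-mono {true}  {false} x⇒y = case x⇒y refl of λ ()

𝟙-∨-disjoint : ∀ x y e → (x ≡ true → e ≡ false) → (y ≡ true → e ≡ false) → (x ∧ y) ≡ false →
               𝟙 x + 𝟙 y + 𝟙 e ≤ 𝟙 ((x ∨ y) ∨ e)
𝟙-∨-disjoint true  y     e x⇒¬e _    x∧y rewrite x⇒¬e refl | x∧y = ≤-refl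
𝟙-∨-disjoint false true  e _    y⇒¬e _   rewrite y⇒¬e refl = ≤-refl
𝟙-∨-disjoint false false e _    _    _   = ≤-refl

∧-≡-true : ∀ {x y} → (x ∧ y) ≡ true → x ≡ true × y ≡ true
∧-≡-true {true} {true} _ = refl , refl

∨-≡-true : ∀ {x y} → (x ∨ y) ≡ true → x ≡ true ⊎ y ≡ true
∨-≡-true {true}  _  = inj₁ refl
∨-≡-true {false} xy = inj₂ xy

eqF-refl : ∀ {n} (i : Fin n) → eqF i i ≡ true
eqF-refl i = Equivalence.to T-≡ (≡⇒≡ᵇ (toℕ i) (toℕ i) refl)

eqF⇒≡ : ∀ {n} (i j : Fin n) → eqF i j ≡ true → i ≡ j
eqF⇒≡ i j e = Fin.toℕ-injective (≡ᵇ⇒≡ (toℕ i) (toℕ j) (Equivalence.from T-≡ e))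

≢⇒eqF-false : ∀ {n} {i j : Fin n} → i ≢ j → eqF i j ≡ false
≢⇒eqF-false {i = i} {j} i≢j with eqF i j in e
... | true  = ⊥-elim (i≢j (eqF⇒≡ i j e))
... | false = refl

eqF-sym : ∀ {n} (i j : Fin n) → eqF i j ≡ eqF j i
eqF-sym i j with eqF i j in i=j
... | true  = sym (subst (λ k → eqF k i ≡ true) (eqF⇒≡ i j i=j) (eqF-refl i))
... | false = sym (≢⇒eqF-false {i = j} {i} λ { refl → case trans (sym i=j) (eqF-refl i) of λ () })

eqF-both⇒≡ : ∀ {n} {a b v : Fin n} → eqF a v ≡ true × eqF b v ≡ true → a ≡ b
eqF-both⇒≡ {a = a} {b} {v} (a=v , b=v) = trans (eqF⇒≡ a v a=v) (sym (eqF⇒≡ b v b=v))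

∑-mono-≤ : ∀ {n} {f g : Fin n → ℕ} → (∀ i → f i ≤ g i) → ∑[ i < n ] f i ≤ ∑[ i < n ] g i
∑-mono-≤ {zero}  f≤g = z≤n
∑-mono-≤ {suc n} f≤g = +-mono-≤ (f≤g zero) (∑-mono-≤ (f≤g ∘ suc))

∑-const : ∀ n c → ∑[ i < n ] c ≡ n * c
∑-const zero    c = refl
∑-const (suc n) c = cong (c +_) (∑-const n c)

∑-zero : ∀ n → ∑[ i < n ] 0 ≡ 0
∑-zero n = trans (∑-const n 0) (*-zeroʳ n)

∑-δ : ∀ {n} (v : Fin n) (f : Fin n → ℕ) → ∑[ i < n ] (𝟙 (eqF v i) * f i) ≡ f v
∑-δ {suc n} zero    f = trans (cong₂ _+_ (*-identityˡ (f zero)) (∑-zero n)) (+-identityʳ (f zero))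
∑-δ {suc n} (suc v) f = ∑-δ v (f ∘ suc)

∑∑-δ : ∀ {n} (a b : Fin n) → ∑[ i < n ] ∑[ j < n ] (𝟙 (eqF a i) * 𝟙 (eqF b j)) ≡ 1
∑∑-δ {n} a b = begin
  ∑[ i < n ] ∑[ j < n ] (𝟙 (eqF a i) * 𝟙 (eqF b j))   ≡⟨ sum-cong-≗ (λ i → *-distribˡ-sum (𝟙 (eqF a i)) (𝟙 ∘ eqF b)) ⟨
  ∑[ i < n ] (𝟙 (eqF a i) * ∑[ j < n ] 𝟙 (eqF b j))   ≡⟨ sum-cong-≗ (λ i → cong (𝟙 (eqF a i) *_) row) ⟩
  ∑[ i < n ] (𝟙 (eqF a i) * 1)                        ≡⟨ ∑-δ a (λ _ → 1) ⟩
  1                                                   ∎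
  where
  open ≡-Reasoning
  row : ∑[ j < n ] 𝟙 (eqF b j) ≡ 1
  row = trans (sum-cong-≗ λ j → sym (*-identityʳ (𝟙 (eqF b j)))) (∑-δ b (λ _ → 1))

∑-sq : ∀ {n} (x : Fin n → ℕ) →
       (∑[ i < n ] x i) * (∑[ i < n ] x i) ≡ ∑[ i < n ] ∑[ j < n ] (x i * x j)
∑-sq {n} x = trans (*-distribʳ-sum (∑[ j < n ] x j) x)
                   (sum-cong-≗ λ i → *-distribˡ-sum (x i) x)

2*m*n≤m*m+n*n : ∀ m n → 2 * (m * n) ≤ m * m + n * n
2*m*n≤m*m+n*n m n = [_,_]′ ordered swapped (≤-total m n)
  where
  ordered : ∀ {m n} → m ≤ n → 2 * (m * n) ≤ m * m + n * n
  ordered {m} m≤n with m≤n⇒∃[o]m+o≡n m≤n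
  ... | d , refl = subst (2 * (m * (m + d)) ≤_) (identity m d) (m≤m+n _ (d * d))
    where
    identity : ∀ m d → 2 * (m * (m + d)) + d * d ≡ m * m + (m + d) * (m + d)
    identity = solve-∀
  swapped : n ≤ m → 2 * (m * n) ≤ m * m + n * n
  swapped n≤m = subst₂ _≤_ (cong (2 *_) (*-comm n m)) (+-comm (n * n) (m * m)) (ordered n≤m)

cauchy-schwarz : ∀ {n} (x : Fin n → ℕ) →
                 (∑[ i < n ] x i) * (∑[ i < n ] x i) ≤ n * ∑[ i < n ] (x i * x i)
cauchy-schwarz {n} x = *-cancelˡ-≤ 2 (begin
  2 * (S * S)                                           ≡⟨ cong (2 *_) (∑-sq x) ⟩
  2 * ∑[ i < n ] ∑[ j < n ] (x i * x j)                 ≡⟨ *-distribˡ-sum 2 (λ i → ∑[ j < n ] (x i * x j)) ⟩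
  ∑[ i < n ] (2 * ∑[ j < n ] (x i * x j))               ≡⟨ sum-cong-≗ (λ i → *-distribˡ-sum 2 (λ j → x i * x j)) ⟩
  ∑[ i < n ] ∑[ j < n ] (2 * (x i * x j))               ≤⟨ ∑-mono-≤ (λ i → ∑-mono-≤ λ j → 2*m*n≤m*m+n*n (x i) (x j)) ⟩
  ∑[ i < n ] ∑[ j < n ] (x i * x i + x j * x j)         ≡⟨ sum-cong-≗ (λ i → ∑-distrib-+ (λ _ → x i * x i) (λ j → x j * x j)) ⟩
  ∑[ i < n ] (∑[ j < n ] (x i * x i) + Q)               ≡⟨ sum-cong-≗ (λ i → cong (_+ Q) (∑-const n (x i * x i))) ⟩
  ∑[ i < n ] (n * (x i * x i) + Q)                      ≡⟨ ∑-distrib-+ (λ i → n * (x i * x i)) (λ _ → Q) ⟩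
  ∑[ i < n ] (n * (x i * x i)) + ∑[ i < n ] Q           ≡⟨ cong₂ _+_ (sym (*-distribˡ-sum n (λ i → x i * x i))) (∑-const n Q) ⟩
  n * Q + n * Q                                         ≡⟨ cong (n * Q +_) (sym (+-identityʳ (n * Q))) ⟩
  2 * (n * Q)                                           ∎)
  where
  open ≤-Reasoning
  S = ∑[ i < n ] x i
  Q = ∑[ i < n ] (x i * x i)

choose-injective : ∀ {n} (p : Fin n → Bool) t → t ≤ ∑[ i < n ] 𝟙 (p i) →
                   Σ[ f ∈ (Fin t → Fin n) ] Injective _≡_ _≡_ f × (∀ i → p (f i) ≡ true)
choose-injective p       zero    _ = (λ ()) , (λ { {()} }) , (λ ())
choose-injective {suc n} p (suc t) t<∑ with p zero in p0
... | true  =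
  let f , f-inj , pf = choose-injective (p ∘ suc) t (≤-pred t<∑)
      g : Fin (suc t) → Fin (suc n)
      g = λ { zero → zero ; (suc i) → suc (f i) }
      g-inj : Injective _≡_ _≡_ g
      g-inj = λ { {zero} {zero} _ → refl ; {suc i} {suc j} eq → cong suc (f-inj (Fin.suc-injective eq)) }
      pg : ∀ i → p (g i) ≡ true
      pg = λ { zero → p0 ; (suc i) → pf i }
  in g , g-inj , pg
... | false =
  let f , f-inj , pf = choose-injective (p ∘ suc) (suc t) t<∑
  in suc ∘ f , f-inj ∘ Fin.suc-injective , pf

[m+n]²≤2*[m²+n²] : ∀ m n → (m + n) * (m + n) ≤ 2 * (m * m + n * n)
[m+n]²≤2*[m²+n²] m n = begin
  (m + n) * (m + n)                  ≡⟨ square-of-sum m n ⟩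
  m * m + n * n + 2 * (m * n)        ≤⟨ +-monoʳ-≤ (m * m + n * n) (2*m*n≤m*m+n*n m n) ⟩
  m * m + n * n + (m * m + n * n)    ≡⟨ cong (m * m + n * n +_) (+-identityʳ (m * m + n * n)) ⟨
  2 * (m * m + n * n)                ∎
  where
  open ≤-Reasoning
  square-of-sum : ∀ m n → (m + n) * (m + n) ≡ m * m + n * n + 2 * (m * n)
  square-of-sum = solve-∀

n*n≤n*[n*n] : ∀ n → n * n ≤ n * (n * n)
n*n≤n*[n*n] zero        = z≤n
n*n≤n*[n*n] n@(suc _)   = *-monoʳ-≤ n (m≤m*n n n)

^-distribʳ-* : ∀ a b k → (a * b) ^ k ≡ a ^ k * b ^ k
^-distribʳ-* a b zero    = refl
^-distribʳ-* a b (suc k) = trans (cong (a * b *_) (^-distribʳ-* a b k)) ([m*n]*[o*p]≡[m*o]*[n*p] a b (a ^ k) (b ^ k))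

n^n>0 : ∀ n → 0 < n ^ n
n^n>0 zero        = s≤s z≤n
n^n>0 n@(suc _)   = m^n>0 n n

1+n≤2^n : ∀ n → 1 ≤ n → suc n ≤ 2 ^ n
1+n≤2^n (suc zero)    _ = ≤-refl
1+n≤2^n (suc (suc n)) _ = begin
  suc (suc (suc n))          ≤⟨ +-monoʳ-≤ 1 (1+n≤2^n (suc n) (s≤s z≤n)) ⟩
  1 + 2 ^ suc n              ≤⟨ +-monoˡ-≤ (2 ^ suc n) (m^n>0 2 (suc n)) ⟩
  2 ^ suc n + 2 ^ suc n      ≡⟨ cong (2 ^ suc n +_) (+-identityʳ (2 ^ suc n)) ⟨
  2 ^ suc (suc n)            ∎
  where open ≤-Reasoning

n^5≤32^N : ∀ {n N} → n ≤ 2 ^ N → n ^ 5 ≤ 32 ^ N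
n^5≤32^N {n} {N} n≤2^N = begin
  n ^ 5          ≤⟨ ^-monoˡ-≤ 5 n≤2^N ⟩
  (2 ^ N) ^ 5    ≡⟨ ^-*-assoc 2 N 5 ⟩
  2 ^ (N * 5)    ≡⟨ cong (2 ^_) (*-comm N 5) ⟩
  2 ^ (5 * N)    ≡⟨ ^-*-assoc 2 5 N ⟨
  32 ^ N         ∎
  where open ≤-Reasoning

binomial-two-terms : ∀ x k → x ^ suc k + suc k * x ^ k ≤ suc x ^ suc k
binomial-two-terms x zero    = ≤-reflexive (identity x)
  where
  identity : ∀ x → x * 1 + 1 * 1 ≡ (1 + x) * 1
  identity = solve-∀
binomial-two-terms x (suc k) = begin
  x ^ (2 + k) + (2 + k) * x ^ (1 + k)                   ≤⟨ m≤m+n _ (suc k * x ^ k) ⟩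
  x ^ (2 + k) + (2 + k) * x ^ (1 + k) + suc k * x ^ k   ≡⟨ identity x (x ^ k) k ⟩
  suc x * (x ^ suc k + suc k * x ^ k)                   ≤⟨ *-monoʳ-≤ (suc x) (binomial-two-terms x k) ⟩
  suc x ^ (2 + k)                                       ∎
  where
  open ≤-Reasoning
  identity : ∀ x y k → x * (x * y) + (2 + k) * (x * y) + (1 + k) * y ≡ (1 + x) * (x * y + (1 + k) * y)
  identity = solve-∀

n!≤n^n : ∀ n → n ! ≤ n ^ n
n!≤n^n zero    = ≤-refl
n!≤n^n (suc n) = *-monoʳ-≤ (suc n) (≤-trans (n!≤n^n n) (^-monoˡ-≤ n (n≤1+n n)))

-- Bernoulli's inequality (1 − 1/(N+1))ᵃ ≥ 1 − a/(N+1) for N = a + r, cleared of denominators.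
bernoulli : ∀ a r → suc (a + r) ^ a * suc r ≤ (a + r) ^ a * suc (a + r)
bernoulli zero    r = ≤-refl
bernoulli (suc a) r = begin
  suc N ^ suc a * suc r              ≡⟨ xy∙z≈y∙xz (suc N) (suc N ^ a) (suc r) ⟩
  suc N ^ a * (suc N * suc r)        ≤⟨ *-monoʳ-≤ (suc N ^ a) step ⟩
  suc N ^ a * (N * suc (suc r))      ≡⟨ x∙yz≈y∙xz (suc N ^ a) N (suc (suc r)) ⟩
  N * (suc N ^ a * suc (suc r))      ≤⟨ *-monoʳ-≤ N induction ⟩
  N * (N ^ a * suc N)                ≡⟨ *-assoc N (N ^ a) (suc N) ⟨
  N ^ suc a * suc N                  ∎
  where
  open ≤-Reasoning
  N = suc (a + r)
  induction : suc N ^ a * suc (suc r) ≤ N ^ a * suc N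
  induction = subst (λ M → suc M ^ a * suc (suc r) ≤ M ^ a * suc M) (+-suc a r) (bernoulli a (suc r))
  step : suc N * suc r ≤ N * suc (suc r)
  step = subst (suc N * suc r ≤_) (sym (*-suc N (suc r))) (+-monoˡ-≤ (N * suc r) (s≤s (m≤n+m r a)))

⌈n/2⌉≤1+⌊n/2⌋ : ∀ n → ⌈ n /2⌉ ≤ suc ⌊ n /2⌋
⌈n/2⌉≤1+⌊n/2⌋ zero          = z≤n
⌈n/2⌉≤1+⌊n/2⌋ (suc zero)    = ≤-refl
⌈n/2⌉≤1+⌊n/2⌋ (suc (suc n)) = s≤s (⌈n/2⌉≤1+⌊n/2⌋ n)

[1+N]^a≤2*N^a : ∀ {a r N} → a + r ≡ N → a ≤ suc r → suc N ^ a ≤ 2 * N ^ a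
[1+N]^a≤2*N^a {a} {r} refl a≤1+r = *-cancelʳ-≤ _ _ (suc r) (begin
  suc (a + r) ^ a * suc r        ≤⟨ bernoulli a r ⟩
  (a + r) ^ a * suc (a + r)      ≤⟨ *-monoʳ-≤ ((a + r) ^ a) (+-monoˡ-≤ r (s≤s a≤1+r)) ⟩
  (a + r) ^ a * (suc (suc r) + r) ≡⟨ cong ((a + r) ^ a *_) (identity r) ⟩
  (a + r) ^ a * (2 * suc r)      ≡⟨ x∙yz≈y∙xz ((a + r) ^ a) 2 (suc r) ⟩
  2 * ((a + r) ^ a * suc r)      ≡⟨ *-assoc 2 ((a + r) ^ a) (suc r) ⟨
  2 * (a + r) ^ a * suc r        ∎)
  where
  open ≤-Reasoning
  identity : ∀ r → suc (suc r) + r ≡ 2 * suc r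
  identity = solve-∀

[1+n]^n≤4*n^n : ∀ n → suc n ^ n ≤ 4 * n ^ n
[1+n]^n≤4*n^n n = begin
  suc n ^ n                    ≡⟨ cong (suc n ^_) halves ⟨
  suc n ^ (h + c)              ≡⟨ ^-distribˡ-+-* (suc n) h c ⟩
  suc n ^ h * suc n ^ c        ≤⟨ *-mono-≤ ([1+N]^a≤2*N^a halves (m≤n⇒m≤1+n (⌊n/2⌋≤⌈n/2⌉ n)))
                                           ([1+N]^a≤2*N^a (trans (+-comm c h) halves) (⌈n/2⌉≤1+⌊n/2⌋ n)) ⟩
  2 * n ^ h * (2 * n ^ c)      ≡⟨ [m*n]*[o*p]≡[m*o]*[n*p] 2 (n ^ h) 2 (n ^ c) ⟩
  4 * (n ^ h * n ^ c)          ≡⟨ cong (4 *_) (^-distribˡ-+-* n h c) ⟨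
  4 * n ^ (h + c)              ≡⟨ cong (λ k → 4 * n ^ k) halves ⟩
  4 * n ^ n                    ∎
  where
  open ≤-Reasoning
  h = ⌊ n /2⌋
  c = ⌈ n /2⌉
  halves : h + c ≡ n
  halves = ⌊n/2⌋+⌈n/2⌉≡n n

n^n≤4^n*n! : ∀ n → n ^ n ≤ 4 ^ n * n !
n^n≤4^n*n! zero    = ≤-refl
n^n≤4^n*n! (suc n) = begin
  suc n * suc n ^ n              ≤⟨ *-monoʳ-≤ (suc n) ([1+n]^n≤4*n^n n) ⟩
  suc n * (4 * n ^ n)            ≤⟨ *-monoʳ-≤ (suc n) (*-monoʳ-≤ 4 (n^n≤4^n*n! n)) ⟩
  suc n * (4 * (4 ^ n * n !))    ≡⟨ identity (suc n) (4 ^ n) (n !) ⟩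
  4 ^ suc n * suc n !            ∎
  where
  open ≤-Reasoning
  identity : ∀ x y z → x * (4 * (y * z)) ≡ 4 * y * (x * z)
  identity = solve-∀

count : {A : Set} → (A → Bool) → List A → ℕ
count q xs = length (filterᵇ q xs)

count-∷ : ∀ {A : Set} (q : A → Bool) x xs → count q (x ∷ xs) ≡ 𝟙 (q x) + count q xs
count-∷ q x xs with q x
... | true  = refl
... | false = refl

count-++ : ∀ {A : Set} (q : A → Bool) xs ys → count q (xs ++ ys) ≡ count q xs + count q ys
count-++ q xs ys = trans (cong length (filter-++ (T? ∘ q) xs ys)) (length-++ (filterᵇ q xs))

count-map : ∀ {A B : Set} (q : B → Bool) (f : A → B) xs → count q (map f xs) ≡ count (q ∘ f) xs
count-map q f []       = refl
count-map q f (x ∷ xs) = begin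
  count q (f x ∷ map f xs)          ≡⟨ count-∷ q (f x) (map f xs) ⟩
  𝟙 (q (f x)) + count q (map f xs)  ≡⟨ cong (𝟙 (q (f x)) +_) (count-map q f xs) ⟩
  𝟙 (q (f x)) + count (q ∘ f) xs    ≡⟨ count-∷ (q ∘ f) x xs ⟨
  count (q ∘ f) (x ∷ xs)            ∎
  where open ≡-Reasoning

count-cong : ∀ {A : Set} {p q : A → Bool} → (∀ x → p x ≡ q x) → ∀ xs → count p xs ≡ count q xs
count-cong         p≗q []       = refl
count-cong {p = p} {q} p≗q (x ∷ xs) = begin
  count p (x ∷ xs)          ≡⟨ count-∷ p x xs ⟩
  𝟙 (p x) + count p xs      ≡⟨ cong₂ _+_ (cong 𝟙 (p≗q x)) (count-cong p≗q xs) ⟩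
  𝟙 (q x) + count q xs      ≡⟨ count-∷ q x xs ⟨
  count q (x ∷ xs)          ∎
  where open ≡-Reasoning

count-const-true : ∀ {A : Set} (xs : List A) → count (λ _ → true) xs ≡ length xs
count-const-true []       = refl
count-const-true (x ∷ xs) = cong suc (count-const-true xs)

count-none : ∀ {A : Set} {q : A → Bool} → (∀ x → q x ≡ false) → ∀ xs → count q xs ≡ 0
count-none         q-false []       = refl
count-none {q = q} q-false (x ∷ xs) = trans (count-∷ q x xs) (cong₂ _+_ (cong 𝟙 (q-false x)) (count-none q-false xs))

count-mono-⊆ : ∀ {A : Set} (q : A → Bool) {xs ys} → xs ⊆ ys → count q xs ≤ count q ys
count-mono-⊆ q xs⊆ys = length-mono-≤ (filter⁺ (T? ∘ q) (T? ∘ q) (λ { refl qx → qx }) xs⊆ys)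

count-mono-∈ : ∀ {A : Set} {p q : A → Bool} xs → (∀ {x} → x ∈ xs → p x ≡ true → q x ≡ true) →
               count p xs ≤ count q xs
count-mono-∈         []       p⇒q = z≤n
count-mono-∈ {p = p} {q} (x ∷ xs) p⇒q = begin
  count p (x ∷ xs)          ≡⟨ count-∷ p x xs ⟩
  𝟙 (p x) + count p xs      ≤⟨ +-mono-≤ (𝟙-mono (p⇒q (here refl))) (count-mono-∈ xs (p⇒q ∘ there)) ⟩
  𝟙 (q x) + count q xs      ≡⟨ count-∷ q x xs ⟨
  count q (x ∷ xs)          ∎
  where open ≤-Reasoning

count-∷≤0 : ∀ {A : Set} (q : A → Bool) x xs → count q (x ∷ xs) ≤ 0 → q x ≡ false
count-∷≤0 q x xs c≤0 with q x
... | false = refl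

count-∷≤1 : ∀ {A : Set} (q : A → Bool) x xs → q x ≡ true → count q (x ∷ xs) ≤ 1 → count q xs ≡ 0
count-∷≤1 q x xs qx c≤1 rewrite count-∷ q x xs | qx = n≤0⇒n≡0 (s≤s⁻¹ c≤1)

count≡0⇒anyL≡false : ∀ {A : Set} (q : A → Bool) xs → count q xs ≡ 0 → anyL q xs ≡ false
count≡0⇒anyL≡false q []       _  = refl
count≡0⇒anyL≡false q (x ∷ xs) c≡0 with q x
... | true  = case c≡0 of λ ()
... | false = count≡0⇒anyL≡false q xs c≡0

count-concatMap-tabulate : ∀ {A B : Set} {n} (q : B → Bool) (h : A → List B) (g : Fin n → A) →
                           count q (concatMap h (tabulate g)) ≡ ∑[ i < n ] count q (h (g i))
count-concatMap-tabulate {n = zero}  q h g = refl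
count-concatMap-tabulate {n = suc n} q h g =
  trans (count-++ q (h (g zero)) (concatMap h (tabulate (g ∘ suc))))
        (cong (count q (h (g zero)) +_) (count-concatMap-tabulate q h (g ∘ suc)))

count-singleton-if : ∀ {A : Set} (q : A → Bool) b x → count q (if b then x ∷ [] else []) ≡ 𝟙 (b ∧ q x)
count-singleton-if q true  x = trans (count-∷ q x []) (+-identityʳ (𝟙 (q x)))
count-singleton-if q false x = refl

∈-subsets⇒⊆ : ∀ {A : Set} {T : List A} E → T ∈ subsets E → T ⊆ E
∈-subsets⇒⊆ []       (here refl) = []
∈-subsets⇒⊆ (x ∷ xs) T∈ with ∈-++⁻ (map (x ∷_) (subsets xs)) T∈
... | inj₂ T∈subsets-xs = x ∷ʳ ∈-subsets⇒⊆ xs T∈subsets-xs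
... | inj₁ T∈map with ∈-map⁻ (x ∷_) T∈map
...   | T′ , T′∈subsets-xs , refl = refl ∷ ∈-subsets⇒⊆ xs T′∈subsets-xs

count-subsets-∷ : ∀ {A : Set} (q : List A → Bool) x xs →
                  count q (subsets (x ∷ xs)) ≡ count (q ∘ (x ∷_)) (subsets xs) + count q (subsets xs)
count-subsets-∷ q x xs = trans (count-++ q (map (x ∷_) (subsets xs)) (subsets xs))
                               (cong (_+ count q (subsets xs)) (count-map q (x ∷_) (subsets xs)))

countSubsets≤ : {A : Set} → ℕ → List A → ℕ
countSubsets≤ k E = count (λ T → length T ≤ᵇ k) (subsets E)

1+m≤ᵇ1+n : ∀ m n → (suc m ≤ᵇ suc n) ≡ (m ≤ᵇ n)
1+m≤ᵇ1+n zero    n = refl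
1+m≤ᵇ1+n (suc m) n = refl

1+m≤ᵇ0 : ∀ m → (suc m ≤ᵇ 0) ≡ false
1+m≤ᵇ0 zero    = refl
1+m≤ᵇ0 (suc m) = refl

countSubsets≤-0 : ∀ {A : Set} (E : List A) → countSubsets≤ 0 E ≡ 1
countSubsets≤-0 []       = refl
countSubsets≤-0 (x ∷ xs) = trans (count-subsets-∷ (λ T → length T ≤ᵇ 0) x xs)
  (cong₂ _+_ (count-none (λ T → 1+m≤ᵇ0 (length T)) (subsets xs)) (countSubsets≤-0 xs))

countSubsets≤-∷ : ∀ {A : Set} k (x : A) xs →
                  countSubsets≤ (suc k) (x ∷ xs) ≡ countSubsets≤ k xs + countSubsets≤ (suc k) xs
countSubsets≤-∷ k x xs = trans (count-subsets-∷ (λ T → length T ≤ᵇ suc k) x xs)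
  (cong (_+ countSubsets≤ (suc k) xs) (count-cong (λ T → 1+m≤ᵇ1+n (length T) k) (subsets xs)))

k!*countSubsets≤ : ∀ {A : Set} (E : List A) k → k ! * countSubsets≤ k E ≤ (length E + k) ^ k
k!*countSubsets≤ []       k       = subst (_≤ k ^ k) (sym (*-identityʳ (k !))) (n!≤n^n k)
k!*countSubsets≤ (x ∷ xs) zero    = ≤-reflexive (cong (1 *_) (countSubsets≤-0 (x ∷ xs)))
k!*countSubsets≤ (x ∷ xs) (suc k) = begin
  suc k ! * countSubsets≤ (suc k) (x ∷ xs)      ≡⟨ cong (suc k ! *_) (countSubsets≤-∷ k x xs) ⟩
  suc k ! * (a + b)                             ≡⟨ *-distribˡ-+ (suc k !) a b ⟩
  suc k * k ! * a + suc k ! * b                 ≡⟨ cong (_+ suc k ! * b) (*-assoc (suc k) (k !) a) ⟩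
  suc k * (k ! * a) + suc k ! * b               ≤⟨ +-mono-≤ (*-monoʳ-≤ (suc k) (k!*countSubsets≤ xs k))
                                                            (k!*countSubsets≤ xs (suc k)) ⟩
  suc k * (m + k) ^ k + (m + suc k) ^ suc k     ≤⟨ +-monoˡ-≤ _ (*-monoʳ-≤ (suc k) (^-monoˡ-≤ k (+-monoʳ-≤ m (n≤1+n k)))) ⟩
  suc k * (m + suc k) ^ k + (m + suc k) ^ suc k ≡⟨ +-comm _ ((m + suc k) ^ suc k) ⟩
  (m + suc k) ^ suc k + suc k * (m + suc k) ^ k ≤⟨ binomial-two-terms (m + suc k) k ⟩
  suc (m + suc k) ^ suc k                       ∎
  where
  open ≤-Reasoning
  m = length xs
  a = countSubsets≤ k xs
  b = countSubsets≤ (suc k) xs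

-- Degrees in graphs without K₂,ₜ

module _ {n} (G : Graph n) where

  degree : Fin n → ℕ
  degree v = ∑[ w < n ] 𝟙 (adj G v w)

  codegree : Fin n → Fin n → ℕ
  codegree a b = ∑[ v < n ] 𝟙 (adj G a v ∧ adj G b v)

  ∑-degree²≡∑-codegree : ∑[ v < n ] (degree v * degree v) ≡ ∑[ a < n ] ∑[ b < n ] codegree a b
  ∑-degree²≡∑-codegree = begin
    ∑[ v < n ] (degree v * degree v)             ≡⟨ sum-cong-≗ (λ v → ∑-sq (λ w → 𝟙 (adj G v w))) ⟩
    ∑[ v < n ] ∑[ a < n ] ∑[ b < n ] path v a b   ≡⟨ ∑-comm (λ v a → ∑[ b < n ] path v a b) ⟩
    ∑[ a < n ] ∑[ v < n ] ∑[ b < n ] path v a b   ≡⟨ sum-cong-≗ (λ a → ∑-comm (λ v b → path v a b)) ⟩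
    ∑[ a < n ] ∑[ b < n ] ∑[ v < n ] path v a b   ≡⟨ sum-cong-≗ (λ a → sum-cong-≗ λ b → sum-cong-≗ (common-neighbour a b)) ⟩
    ∑[ a < n ] ∑[ b < n ] codegree a b            ∎
    where
    open ≡-Reasoning
    path : Fin n → Fin n → Fin n → ℕ
    path v a b = 𝟙 (adj G v a) * 𝟙 (adj G v b)
    common-neighbour : ∀ a b v → path v a b ≡ 𝟙 (adj G a v ∧ adj G b v)
    common-neighbour a b v rewrite Graph.sym G v a | Graph.sym G v b = sym (𝟙-∧ (adj G a v) (adj G b v))

  neighbour≢ : ∀ {u v} → adj G u v ≡ true → v ≢ u
  neighbour≢ {u} uv refl = case trans (sym uv) (irrefl G u) of λ ()

  codegree≤n : ∀ a b → codegree a b ≤ n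
  codegree≤n a b = begin
    codegree a b   ≤⟨ ∑-mono-≤ (λ v → 𝟙≤1 (adj G a v ∧ adj G b v)) ⟩
    ∑[ v < n ] 1   ≡⟨ trans (∑-const n 1) (*-identityʳ n) ⟩
    n              ∎
    where open ≤-Reasoning

  K2Free⇒codegree< : ∀ {t} → K2Free t G → ∀ {a b} → a ≢ b → codegree a b < t
  K2Free⇒codegree< {t} free {a} {b} a≢b with codegree a b <? t
  ... | yes codeg<t = codeg<t
  ... | no  codeg≮t = ⊥-elim (free (a , b , f , a≢b , f-inj , in-K2))
    where
    common : Σ[ f ∈ (Fin t → Fin n) ] Injective _≡_ _≡_ f × (∀ i → (adj G a (f i) ∧ adj G b (f i)) ≡ true)
    common = choose-injective (λ v → adj G a v ∧ adj G b v) t (≮⇒≥ codeg≮t)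
    f = proj₁ common
    f-inj = proj₁ (proj₂ common)
    in-K2 : ∀ i → f i ≢ a × f i ≢ b × adj G a (f i) ≡ true × adj G b (f i) ≡ true
    in-K2 i with adj G a (f i) in fa | adj G b (f i) in fb | proj₂ (proj₂ common) i
    ... | true | true | _ = neighbour≢ fa , neighbour≢ fb , refl , refl

  ∑-codegree≤ : ∀ {t} → K2Free t G → ∑[ a < n ] ∑[ b < n ] codegree a b ≤ n * (n + n * t)
  ∑-codegree≤ {t} free = begin
    ∑[ a < n ] ∑[ b < n ] codegree a b               ≤⟨ ∑-mono-≤ (λ a → ∑-mono-≤ (codegree≤ a)) ⟩
    ∑[ a < n ] ∑[ b < n ] (𝟙 (eqF a b) * n + t)      ≡⟨ sum-cong-≗ row ⟩
    ∑[ a < n ] (n + n * t)                           ≡⟨ ∑-const n (n + n * t) ⟩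
    n * (n + n * t)                                  ∎
    where
    open ≤-Reasoning
    codegree≤ : ∀ a b → codegree a b ≤ 𝟙 (eqF a b) * n + t
    codegree≤ a b with eqF a b in a=b
    ... | true  = ≤-trans (codegree≤n a b) (subst (_≤ 1 * n + t) (*-identityˡ n) (m≤m+n (1 * n) t))
    ... | false = <⇒≤ (K2Free⇒codegree< free λ { refl → case trans (sym a=b) (eqF-refl a) of λ () })
    row : ∀ a → ∑[ b < n ] (𝟙 (eqF a b) * n + t) ≡ n + n * t
    row a = trans (∑-distrib-+ (λ b → 𝟙 (eqF a b) * n) (λ _ → t)) (cong₂ _+_ (∑-δ a (λ _ → n)) (∑-const n t))

  count-edges : ∀ (q : Fin n × Fin n → Bool) →
                count q (edges G) ≡ ∑[ i < n ] ∑[ j < n ] 𝟙 (((toℕ i <ᵇ toℕ j) ∧ adj G i j) ∧ q (i , j))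
  count-edges q =
    trans (count-concatMap-tabulate q row id)
          (sum-cong-≗ λ i → trans (count-concatMap-tabulate q (cell i) id)
                                  (sum-cong-≗ λ j → count-singleton-if q ((toℕ i <ᵇ toℕ j) ∧ adj G i j) (i , j)))
    where
    cell : Fin n → Fin n → List (Fin n × Fin n)
    cell i j = if (toℕ i <ᵇ toℕ j) ∧ adj G i j then (i , j) ∷ [] else []
    row : Fin n → List (Fin n × Fin n)
    row i = concatMap (cell i) (allFin n)

  length-edges≤∑-degree : length (edges G) ≤ ∑[ v < n ] degree v
  length-edges≤∑-degree = begin
    length (edges G)                     ≡⟨ count-const-true (edges G) ⟨
    count (λ _ → true) (edges G)         ≡⟨ count-edges (λ _ → true) ⟩
    ∑[ i < n ] ∑[ j < n ] 𝟙 (((toℕ i <ᵇ toℕ j) ∧ adj G i j) ∧ true)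
                                         ≤⟨ ∑-mono-≤ (λ i → ∑-mono-≤ (edge⇒adjacent i)) ⟩
    ∑[ v < n ] degree v                  ∎
    where
    open ≤-Reasoning
    edge⇒adjacent : ∀ i j → 𝟙 (((toℕ i <ᵇ toℕ j) ∧ adj G i j) ∧ true) ≤ 𝟙 (adj G i j)
    edge⇒adjacent i j = ≤-trans (≤-reflexive (cong 𝟙 (∧-identityʳ _))) (𝟙-∧-≤ʳ (toℕ i <ᵇ toℕ j) (adj G i j))

  K2Free⇒[e+n]²≤[2t+4]n³ : ∀ {t} → K2Free t G →
    (length (edges G) + n) * (length (edges G) + n) ≤ (2 * t + 4) * (n * (n * n))
  K2Free⇒[e+n]²≤[2t+4]n³ {t} free = begin
    (m + n) * (m + n)                             ≤⟨ [m+n]²≤2*[m²+n²] m n ⟩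
    2 * (m * m + n * n)                           ≤⟨ *-monoʳ-≤ 2 (+-mono-≤ m²≤ (n*n≤n*[n*n] n)) ⟩
    2 * (n * (n * (n + n * t)) + n * (n * n))     ≡⟨ identity n t ⟩
    (2 * t + 4) * (n * (n * n))                   ∎
    where
    open ≤-Reasoning
    m = length (edges G)
    m²≤ : m * m ≤ n * (n * (n + n * t))
    m²≤ = begin
      m * m                                          ≤⟨ *-mono-≤ (length-edges≤∑-degree) (length-edges≤∑-degree) ⟩
      (∑[ v < n ] degree v) * (∑[ v < n ] degree v)   ≤⟨ cauchy-schwarz degree ⟩
      n * ∑[ v < n ] (degree v * degree v)           ≡⟨ cong (n *_) ∑-degree²≡∑-codegree ⟩
      n * ∑[ a < n ] ∑[ b < n ] codegree a b         ≤⟨ *-monoʳ-≤ n (∑-codegree≤ free) ⟩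
      n * (n * (n + n * t))                          ∎
    identity : ∀ n t → 2 * (n * (n * (n + n * t)) + n * (n * n)) ≡ (2 * t + 4) * (n * (n * n))
    identity = solve-∀

-- Cycles and forests

least-witness : ∀ {P : ℕ → Set} → (∀ k → Dec (P k)) → ∀ {j} → P j →
                Σ[ m ∈ ℕ ] P m × m ≤ j × (∀ {k} → k < m → ¬ P k)
least-witness {P} P? {j} pj with search (suc j)
  where
  search : ∀ j → (∀ {k} → k < j → ¬ P k) ⊎ Σ[ m ∈ ℕ ] P m × m < j × (∀ {k} → k < m → ¬ P k)
  search zero    = inj₁ λ ()
  search (suc j) with search j
  ... | inj₂ (m , pm , m<j , below) = inj₂ (m , pm , m<n⇒m<1+n m<j , below)
  ... | inj₁ none with P? j
  ...   | yes pj = inj₂ (j , pj , n<1+n j , none)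
  ...   | no ¬pj = inj₁ λ k<1+j → case m<1+n⇒m<n∨m≡n k<1+j of λ { (inj₁ k<j) → none k<j ; (inj₂ refl) → ¬pj }
... | inj₁ none                  = ⊥-elim (none (n<1+n j) pj)
... | inj₂ (m , pm , m≤j , below) = m , pm , s≤s⁻¹ m≤j , below

anyL-∈ : ∀ {A : Set} (p : A → Bool) {x xs} → x ∈ xs → p x ≡ true → anyL p xs ≡ true
anyL-∈ p {xs = y ∷ ys} (here refl) px rewrite px = refl
anyL-∈ p {xs = y ∷ ys} (there x∈ys) px rewrite anyL-∈ p x∈ys px = ∨-zeroʳ (p y)

∈-allLists : ∀ n (vs : List (Fin n)) → vs ∈ allLists n (length vs)
∈-allLists n []       = here refl
∈-allLists n (v ∷ vs) =
  ∈-concatMap⁺ (λ us → map (_∷ us) (allFin n)) (Any.map (λ { refl → ∈-map⁺ (_∷ vs) (∈-allFin v) }) (∈-allLists n vs))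

isCycle⇒hasCycle : ∀ {n} (A : Fin n → Fin n → Bool) vs → 3 ≤ length vs → length vs ≤ n →
                   isCycle A vs ≡ true → hasCycleB n A ≡ true
isCycle⇒hasCycle {n} A vs 3≤len len≤n cyc =
  anyL-∈ (λ k → (2 <ᵇ k) ∧ anyL (isCycle A) (allLists n k)) (∈-upTo⁺ (s≤s len≤n))
    (cong₂ _∧_ (Equivalence.to T-≡ (<⇒<ᵇ 3≤len)) (anyL-∈ (isCycle A) (∈-allLists n vs) cyc))

segment : ∀ {n} → (ℕ → Fin n) → ℕ → ℕ → List (Fin n)
segment w i zero    = []
segment w i (suc L) = w i ∷ segment w (suc i) L

module _ {n} (w : ℕ → Fin n) where

  length-segment : ∀ i L → length (segment w i L) ≡ L
  length-segment i zero    = refl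
  length-segment i (suc L) = cong suc (length-segment (suc i) L)

  lastV-segment : ∀ i L → lastV (w i) (segment w (suc i) L) ≡ w (i + L)
  lastV-segment i zero    = cong w (sym (+-identityʳ i))
  lastV-segment i (suc L) = trans (lastV-segment (suc i) L) (cong w (sym (+-suc i L)))

  walkOK-segment : (A : Fin n → Fin n → Bool) → (∀ k → A (w k) (w (suc k)) ≡ true) →
                   ∀ i L → walkOK A (w i) (segment w (suc i) L) ≡ true
  walkOK-segment A step i zero    = refl
  walkOK-segment A step i (suc L) rewrite step i = walkOK-segment A step (suc i) L

  anyL-eqF-segment : ∀ x j L → (∀ {q} → j ≤ q → q < j + L → x ≢ w q) → anyL (eqF x) (segment w j L) ≡ false
  anyL-eqF-segment x j zero    _  = refl
  anyL-eqF-segment x j (suc L) x∉ =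
    cong₂ _∨_ (≢⇒eqF-false (x∉ ≤-refl (subst (j <_) (sym (+-suc j L)) (s≤s (m≤m+n j L)))))
              (anyL-eqF-segment x (suc j) L λ {q} j<q q< → x∉ (<⇒≤ j<q) (subst (q <_) (sym (+-suc j L)) q<))

  distinctB-segment : ∀ i L → (∀ {p q} → i ≤ p → p < q → q < i + L → w p ≢ w q) → distinctB (segment w i L) ≡ true
  distinctB-segment i zero    _        = refl
  distinctB-segment i (suc L) distinct =
    cong₂ _∧_ (cong not (anyL-eqF-segment (w i) (suc i) L λ i<q q< → distinct ≤-refl i<q (shift q<)))
              (distinctB-segment (suc i) L λ i<p p<q q< → distinct (<⇒≤ i<p) p<q (shift q<))
    where
    shift : ∀ {q} → q < suc i + L → q < i + suc L
    shift {q} = subst (q <_) (sym (+-suc i L))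

module _ {n} (A : Fin n → Fin n → Bool) (irrefl : ∀ v → A v v ≡ false) (w : ℕ → Fin n)
         (step : ∀ k → A (w k) (w (suc k)) ≡ true) (no-backtrack : ∀ k → w (suc (suc k)) ≢ w k) where

  Repeat : ℕ → Set
  Repeat j = Σ[ i ∈ Fin j ] w (toℕ i) ≡ w j

  -- The first repetition w a ≡ w m closes the cycle w a, …, w (m ∸ 1), which has at least three
  -- vertices because A is irreflexive and the walk never backtracks.
  nonBacktrackingWalk⇒hasCycle : hasCycleB n A ≡ true
  nonBacktrackingWalk⇒hasCycle with Fin.pigeonhole (n<1+n n) (w ∘ toℕ)
  ... | i₀ , j₀ , i₀<j₀ , same
    with least-witness {P = Repeat} (λ j → Fin.any? λ i → w (toℕ i) Fin.≟ w j) {toℕ j₀}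
                       (fromℕ< i₀<j₀ , trans (cong w (Fin.toℕ-fromℕ< i₀<j₀)) same)
  ... | m , (i , closes) , m≤j₀ , first with m≤n⇒∃[o]m+o≡n (Fin.toℕ<n i)
  ... | l , a+1+l≡m = close l a+1+l≡m
    where
    a = toℕ i
    m≤n : m ≤ n
    m≤n = ≤-trans m≤j₀ (s≤s⁻¹ (Fin.toℕ<n j₀))
    close : ∀ L → suc a + L ≡ m → hasCycleB n A ≡ true
    close zero e = case trans (sym (irrefl (w a))) (subst (λ v → A (w a) v ≡ true) w[1+a]≡wa (step a)) of λ ()
      where
      w[1+a]≡wa : w (suc a) ≡ w a
      w[1+a]≡wa = trans (cong w (trans (sym (+-identityʳ (suc a))) e)) (sym closes)
    close (suc zero) e = ⊥-elim (no-backtrack a (trans (cong w (trans (cong suc (+-comm 1 a)) e)) (sym closes)))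
    close (suc (suc o)) e =
      isCycle⇒hasCycle A (segment w a K) 3≤K K≤n
        (cong₂ _∧_ (distinctB-segment w a K distinct) (cong₂ _∧_ (walkOK-segment w A step a L) closing-edge))
      where
      L = suc (suc o)
      K = suc L
      3≤K : 3 ≤ length (segment w a K)
      3≤K = subst (3 ≤_) (sym (length-segment w a K)) (s≤s (s≤s (s≤s z≤n)))
      K≤n : length (segment w a K) ≤ n
      K≤n = subst (_≤ n) (sym (length-segment w a K)) (≤-trans (≤-trans (m≤n+m K a) (≤-reflexive (trans (+-suc a L) e))) m≤n)
      distinct : ∀ {p q} → a ≤ p → p < q → q < a + K → w p ≢ w q
      distinct _ p<q q<a+K wp≡wq =
        first (subst (_ <_) (trans (+-suc a L) e) q<a+K) (fromℕ< p<q , trans (cong w (Fin.toℕ-fromℕ< p<q)) wp≡wq)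
      closing-edge : A (lastV (w a) (segment w (suc a) L)) (w a) ≡ true
      closing-edge = subst₂ (λ u v → A u v ≡ true) (sym (lastV-segment w a L)) (trans (cong w e) (sym closes)) (step (a + L))

module _ {n : ℕ} where

  size : (Fin n → Bool) → ℕ
  size S = ∑[ a < n ] 𝟙 (S a)

  _-_ : (Fin n → Bool) → Fin n → (Fin n → Bool)
  (S - v) a = S a ∧ not (eqF v a)

  𝟙-remove : ∀ S {v} → S v ≡ true → ∀ a → 𝟙 (S a) ≡ 𝟙 ((S - v) a) + 𝟙 (eqF v a)
  𝟙-remove S {v} Sv a with eqF v a in v=a
  ... | true  = begin
    𝟙 (S a)                 ≡⟨ cong (𝟙 ∘ S) (eqF⇒≡ v a v=a) ⟨
    𝟙 (S v)                 ≡⟨ cong 𝟙 Sv ⟩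
    1                       ≡⟨ cong (λ x → 𝟙 x + 1) (∧-zeroʳ (S a)) ⟨
    𝟙 (S a ∧ false) + 1     ∎
    where open ≡-Reasoning
  ... | false = trans (cong 𝟙 (sym (∧-identityʳ (S a)))) (sym (+-identityʳ _))

  ∑-remove : ∀ S {v} → S v ≡ true → (f : Fin n → ℕ) →
             ∑[ a < n ] (𝟙 (S a) * f a) ≡ ∑[ a < n ] (𝟙 ((S - v) a) * f a) + f v
  ∑-remove S {v} Sv f = begin
    ∑[ a < n ] (𝟙 (S a) * f a)                                   ≡⟨ sum-cong-≗ split ⟩
    ∑[ a < n ] (𝟙 (S′ a) * f a + 𝟙 (eqF v a) * f a)              ≡⟨ ∑-distrib-+ (λ a → 𝟙 (S′ a) * f a) (λ a → 𝟙 (eqF v a) * f a) ⟩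
    ∑[ a < n ] (𝟙 (S′ a) * f a) + ∑[ a < n ] (𝟙 (eqF v a) * f a) ≡⟨ cong (∑[ a < n ] (𝟙 (S′ a) * f a) +_) (∑-δ v f) ⟩
    ∑[ a < n ] (𝟙 (S′ a) * f a) + f v                            ∎
    where
    open ≡-Reasoning
    S′ = S - v
    split : ∀ a → 𝟙 (S a) * f a ≡ 𝟙 (S′ a) * f a + 𝟙 (eqF v a) * f a
    split a = trans (cong (_* f a) (𝟙-remove S Sv a)) (*-distribʳ-+ (f a) (𝟙 (S′ a)) (𝟙 (eqF v a)))

  size-remove : ∀ S {v} → S v ≡ true → size S ≡ suc (size (S - v))
  size-remove S {v} Sv = begin
    size S                                     ≡⟨ sum-cong-≗ (λ a → sym (*-identityʳ (𝟙 (S a)))) ⟩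
    ∑[ a < n ] (𝟙 (S a) * 1)                   ≡⟨ ∑-remove S Sv (λ _ → 1) ⟩
    ∑[ a < n ] (𝟙 ((S - v) a) * 1) + 1        ≡⟨ cong (_+ 1) (sum-cong-≗ (λ a → *-identityʳ (𝟙 ((S - v) a)))) ⟩
    size (S - v) + 1                           ≡⟨ +-comm (size (S - v)) 1 ⟩
    suc (size (S - v))                         ∎
    where open ≡-Reasoning

module _ {n} (A : Fin n → Fin n → Bool) where

  degreeIn : (Fin n → Bool) → Fin n → ℕ
  degreeIn S v = ∑[ b < n ] (𝟙 (S b) * 𝟙 (A v b))

  minDegree2⇒hasCycle : (∀ v → A v v ≡ false) → (S : Fin n → Bool) → (∀ v → S v ≡ true → 2 ≤ degreeIn S v) →
                        ∀ v₀ → S v₀ ≡ true → hasCycleB n A ≡ true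
  minDegree2⇒hasCycle irrefl S 2≤deg v₀ Sv₀ = nonBacktrackingWalk⇒hasCycle A irrefl w step no-backtrack
    where
    V = Σ[ v ∈ Fin n ] S v ≡ true

    step-away : (u : V) (v : V) → Σ[ x ∈ V ] A (proj₁ v) (proj₁ x) ≡ true × proj₁ x ≢ proj₁ u
    step-away (u , _) (v , Sv)
      with choose-injective (λ b → S b ∧ A v b) 2 (subst (2 ≤_) (sum-cong-≗ λ b → sym (𝟙-∧ (S b) (A v b))) (2≤deg v Sv))
    ... | f , f-inj , nbr with f zero Fin.≟ u
    ...   | yes f0≡u = (f (suc zero) , proj₁ (∧-≡-true (nbr (suc zero)))) , proj₂ (∧-≡-true (nbr (suc zero))) ,
                       λ f1≡u → case f-inj (trans f1≡u (sym f0≡u)) of λ ()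
    ...   | no  f0≢u = (f zero , proj₁ (∧-≡-true (nbr zero))) , proj₂ (∧-≡-true (nbr zero)) , f0≢u

    -- a state is the pair (previous vertex, current vertex)
    walk : ℕ → V × V
    walk zero    = (v₀ , Sv₀) , (v₀ , Sv₀)
    walk (suc k) = proj₂ (walk k) , proj₁ (step-away (proj₁ (walk k)) (proj₂ (walk k)))

    w : ℕ → Fin n
    w k = proj₁ (proj₂ (walk k))

    step : ∀ k → A (w k) (w (suc k)) ≡ true
    step k = proj₁ (proj₂ (step-away (proj₁ (walk k)) (proj₂ (walk k))))

    no-backtrack : ∀ k → w (suc (suc k)) ≢ w k
    no-backtrack k = proj₂ (proj₂ (step-away (proj₁ (walk (suc k))) (proj₂ (walk (suc k)))))


  edgeWeight : (Fin n → Bool) → ℕ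
  edgeWeight S = ∑[ a < n ] (𝟙 (S a) * degreeIn S a)

  edgeWeight-remove : (∀ a b → A a b ≡ A b a) → ∀ S {v} → S v ≡ true →
                      edgeWeight S ≤ edgeWeight (S - v) + 2 * degreeIn S v
  edgeWeight-remove A-sym S {v} Sv = begin
    edgeWeight S                                                ≡⟨ ∑-remove S Sv (degreeIn S) ⟩
    ∑[ a < n ] (𝟙 (S′ a) * degreeIn S a) + d                   ≡⟨ cong (_+ d) (sum-cong-≗ split) ⟩
    ∑[ a < n ] (𝟙 (S′ a) * degreeIn S′ a + to-v a) + d         ≡⟨ cong (_+ d) (∑-distrib-+ (λ a → 𝟙 (S′ a) * degreeIn S′ a) to-v) ⟩
    edgeWeight S′ + ∑[ a < n ] to-v a + d                       ≤⟨ +-monoˡ-≤ d (+-monoʳ-≤ (edgeWeight S′) (∑-mono-≤ back-edge)) ⟩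
    edgeWeight S′ + d + d                                       ≡⟨ +-assoc (edgeWeight S′) d d ⟩
    edgeWeight S′ + (d + d)                                     ≡⟨ cong (λ x → edgeWeight S′ + (d + x)) (+-identityʳ d) ⟨
    edgeWeight S′ + 2 * d                                       ∎
    where
    open ≤-Reasoning
    S′ = S - v
    d = degreeIn S v
    to-v : Fin n → ℕ
    to-v a = 𝟙 (S′ a) * 𝟙 (A a v)
    split : ∀ a → 𝟙 (S′ a) * degreeIn S a ≡ 𝟙 (S′ a) * degreeIn S′ a + to-v a
    split a = trans (cong (𝟙 (S′ a) *_) (∑-remove S Sv (λ b → 𝟙 (A a b)))) (*-distribˡ-+ (𝟙 (S′ a)) _ _)
    back-edge : ∀ a → to-v a ≤ 𝟙 (S a) * 𝟙 (A v a)
    back-edge a = *-mono-≤ (𝟙-mono (proj₁ ∘ ∧-≡-true {S a})) (≤-reflexive (cong 𝟙 (A-sym a v)))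

  module _ (A-sym : ∀ a b → A a b ≡ A b a) (irrefl : ∀ v → A v v ≡ false) (acyclic : hasCycleB n A ≡ false) where

    edgeWeight≤2*size : ∀ k S → size S ≡ k → edgeWeight S ≤ 2 * k
    edgeWeight≤2*size k S |S|≡k with Fin.any? (λ v → (S v Bool.≟ true) ×-dec (degreeIn S v ≤? 1))
    edgeWeight≤2*size zero    S |S|≡0   | yes (v , Sv , _) = case trans (sym (size-remove S Sv)) |S|≡0 of λ ()
    edgeWeight≤2*size (suc k) S |S|≡1+k | yes (v , Sv , d≤1) = begin
      edgeWeight S                            ≤⟨ edgeWeight-remove A-sym S Sv ⟩
      edgeWeight (S - v) + 2 * degreeIn S v   ≤⟨ +-mono-≤ (edgeWeight≤2*size k (S - v) |S-v|≡k) (*-monoʳ-≤ 2 d≤1) ⟩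
      2 * k + 2 * 1                           ≡⟨ *-distribˡ-+ 2 k 1 ⟨
      2 * (k + 1)                             ≡⟨ cong (2 *_) (+-comm k 1) ⟩
      2 * suc k                               ∎
      where
      open ≤-Reasoning
      |S-v|≡k : size (S - v) ≡ k
      |S-v|≡k = suc-injective (trans (sym (size-remove S Sv)) |S|≡1+k)
    edgeWeight≤2*size k S _ | no no-leaf with Fin.any? (λ v → S v Bool.≟ true)
    ... | yes (v₀ , Sv₀) = case trans (sym acyclic) (minDegree2⇒hasCycle irrefl S 2≤deg v₀ Sv₀) of λ ()
      where
      2≤deg : ∀ v → S v ≡ true → 2 ≤ degreeIn S v
      2≤deg v Sv = ≰⇒> λ d≤1 → no-leaf (v , Sv , d≤1)
    ... | no empty = ≤-trans (∑-mono-≤ outside) (≤-trans (≤-reflexive (∑-zero n)) z≤n)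
      where
      outside : ∀ a → 𝟙 (S a) * degreeIn S a ≤ 0
      outside a with S a in Sa
      ... | true  = ⊥-elim (empty (a , Sa))
      ... | false = z≤n

    acyclic⇒∑∑≤2n : ∑[ a < n ] ∑[ b < n ] 𝟙 (A a b) ≤ 2 * n
    acyclic⇒∑∑≤2n = begin
      ∑[ a < n ] ∑[ b < n ] 𝟙 (A a b)   ≡⟨ sum-cong-≗ (λ a → sym (trans (*-identityˡ _) (sum-cong-≗ (*-identityˡ ∘ 𝟙 ∘ A a)))) ⟩
      edgeWeight (λ _ → true)           ≤⟨ edgeWeight≤2*size n (λ _ → true) (trans (∑-const n 1) (*-identityʳ n)) ⟩
      2 * n                             ∎
      where open ≤-Reasoning

-- Spanning trees

-- 16 = 4² comes from nⁿ ≤ 4ⁿ n!, and 2t + 4 from (e + n)² ≤ (2t + 4) n³.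
Kₜ : ℕ → ℕ
Kₜ t = 16 * (2 * t + 4)

1≤Kₜ : ∀ t → 1 ≤ Kₜ t
1≤Kₜ t = ≤-trans (≤-trans (s≤s z≤n) (m≤n+m 4 (2 * t))) (m≤n*m (2 * t + 4) 16)

joins : ∀ {n} → Fin n → Fin n → Fin n × Fin n → Bool
joins u v (a , b) = (eqF a u ∧ eqF b v) ∨ (eqF a v ∧ eqF b u)

edgeAdj-sym : ∀ {n} (T : List (Fin n × Fin n)) u v → edgeAdj T u v ≡ edgeAdj T v u
edgeAdj-sym []             u v = refl
edgeAdj-sym ((a , b) ∷ T) u v = cong₂ _∨_ (∨-comm (eqF a u ∧ eqF b v) (eqF a v ∧ eqF b u)) (edgeAdj-sym T u v)

module _ {n} (G : Graph n) where

  -- Both ⊆edges⇒ordered and ⊆edges⇒new are read off count-edges: a sublist of edges G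
  -- contains no more elements satisfying any predicate than edges G itself.
  ⊆edges⇒ordered : ∀ {a b T} → (a , b) ∷ T ⊆ edges G → toℕ a < toℕ b
  ⊆edges⇒ordered {a} {b} {T} ⊆E =
    <ᵇ⇒< (toℕ a) (toℕ b) (Equivalence.from T-≡ (not-injective (count-∷≤0 reversed (a , b) T (begin
      count reversed ((a , b) ∷ T)   ≤⟨ count-mono-⊆ reversed ⊆E ⟩
      count reversed (edges G)       ≡⟨ count-edges G reversed ⟩
      ∑[ i < n ] ∑[ j < n ] 𝟙 (((toℕ i <ᵇ toℕ j) ∧ adj G i j) ∧ reversed (i , j))
                                     ≡⟨ sum-cong-≗ (λ i → trans (sum-cong-≗ (never i)) (∑-zero n)) ⟩
      ∑[ i < n ] 0                   ≡⟨ ∑-zero n ⟩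
      0                              ∎))))
    where
    open ≤-Reasoning
    reversed : Fin n × Fin n → Bool
    reversed (i , j) = not (toℕ i <ᵇ toℕ j)
    contradictory : ∀ x y → ((x ∧ y) ∧ not x) ≡ false
    contradictory true  y = ∧-zeroʳ y
    contradictory false y = refl
    never : ∀ i j → 𝟙 (((toℕ i <ᵇ toℕ j) ∧ adj G i j) ∧ reversed (i , j)) ≡ 0
    never i j = cong 𝟙 (contradictory (toℕ i <ᵇ toℕ j) (adj G i j))

  ⊆edges⇒loopless : ∀ {a b T} → (a , b) ∷ T ⊆ edges G → a ≢ b
  ⊆edges⇒loopless ⊆E a≡b = <-irrefl (cong toℕ a≡b) (⊆edges⇒ordered ⊆E)

  ⊆edges⇒new : ∀ {a b T} → (a , b) ∷ T ⊆ edges G → edgeAdj T a b ≡ false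
  ⊆edges⇒new {a} {b} {T} ⊆E = count≡0⇒anyL≡false (joins a b) T (count-∷≤1 (joins a b) (a , b) T joins-itself (begin
    count (joins a b) ((a , b) ∷ T)                                                   ≤⟨ count-mono-⊆ (joins a b) ⊆E ⟩
    count (joins a b) (edges G)                                                       ≡⟨ count-edges G (joins a b) ⟩
    ∑[ i < n ] ∑[ j < n ] 𝟙 (((toℕ i <ᵇ toℕ j) ∧ adj G i j) ∧ joins a b (i , j))     ≤⟨ ∑-mono-≤ (λ i → ∑-mono-≤ (only-edge i)) ⟩
    ∑[ i < n ] ∑[ j < n ] (𝟙 (eqF a i) * 𝟙 (eqF b j))                                 ≡⟨ ∑∑-δ a b ⟩
    1                                                                                 ∎))
    where
    open ≤-Reasoning
    a<b = ⊆edges⇒ordered ⊆E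
    joins-itself : joins a b (a , b) ≡ true
    joins-itself rewrite eqF-refl a | eqF-refl b = refl
    only-edge : ∀ i j → 𝟙 (((toℕ i <ᵇ toℕ j) ∧ adj G i j) ∧ joins a b (i , j)) ≤ 𝟙 (eqF a i) * 𝟙 (eqF b j)
    only-edge i j = ≤-trans (𝟙-mono forward) (≤-reflexive (𝟙-∧ (eqF a i) (eqF b j)))
      where
      forward : (((toℕ i <ᵇ toℕ j) ∧ adj G i j) ∧ joins a b (i , j)) ≡ true → (eqF a i ∧ eqF b j) ≡ true
      forward e with ∧-≡-true e
      ... | i<ᵇj∧ij , ij-joins with ∨-≡-true ij-joins
      ...   | inj₁ same rewrite eqF-sym a i | eqF-sym b j = same
      ...   | inj₂ flipped with ∧-≡-true flipped
      ...     | i=b , j=a = ⊥-elim (<-asym a<b (subst₂ _<_ (cong toℕ (eqF⇒≡ i b i=b)) (cong toℕ (eqF⇒≡ j a j=a))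
                                      (<ᵇ⇒< (toℕ i) (toℕ j) (Equivalence.from T-≡ (proj₁ (∧-≡-true i<ᵇj∧ij))))))

  ⊆edges⇒irrefl : ∀ {T} → T ⊆ edges G → ∀ v → edgeAdj T v v ≡ false
  ⊆edges⇒irrefl {[]}          _  v = refl
  ⊆edges⇒irrefl {(a , b) ∷ T} ⊆E v =
    cong₂ _∨_ (trans (∨-idem (eqF a v ∧ eqF b v)) (¬-not (λ e → ⊆edges⇒loopless ⊆E (eqF-both⇒≡ (∧-≡-true e)))))
              (⊆edges⇒irrefl (∷ˡ⁻ ⊆E) v)

  2*length≤∑∑edgeAdj : ∀ {T} → T ⊆ edges G → 2 * length T ≤ ∑[ u < n ] ∑[ v < n ] 𝟙 (edgeAdj T u v)
  2*length≤∑∑edgeAdj {[]}          _  = z≤n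
  2*length≤∑∑edgeAdj {(a , b) ∷ T} ⊆E = begin
    2 * suc (length T)                                 ≡⟨ *-suc 2 (length T) ⟩
    1 + 1 + 2 * length T                               ≤⟨ +-monoʳ-≤ 2 (2*length≤∑∑edgeAdj (∷ˡ⁻ ⊆E)) ⟩
    1 + 1 + ∑∑ E                                       ≡⟨ cong (λ k → k + ∑∑ E) (cong₂ _+_ forward-once backward-once) ⟨
    ∑∑ forward + ∑∑ backward + ∑∑ E                    ≡⟨ cong (_+ ∑∑ E) (∑∑-distrib-+ forward backward) ⟨
    ∑∑ (λ u v → forward u v + backward u v) + ∑∑ E     ≡⟨ ∑∑-distrib-+ (λ u v → forward u v + backward u v) E ⟨
    ∑∑ (λ u v → forward u v + backward u v + E u v)    ≤⟨ ∑-mono-≤ (λ u → ∑-mono-≤ (new-cells u)) ⟩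
    ∑[ u < n ] ∑[ v < n ] 𝟙 (edgeAdj ((a , b) ∷ T) u v) ∎
    where
    open ≤-Reasoning
    ∑∑ : (Fin n → Fin n → ℕ) → ℕ
    ∑∑ f = ∑[ u < n ] ∑[ v < n ] f u v
    ∑∑-distrib-+ : ∀ f g → ∑∑ (λ u v → f u v + g u v) ≡ ∑∑ f + ∑∑ g
    ∑∑-distrib-+ f g = trans (sum-cong-≗ λ u → ∑-distrib-+ (f u) (g u))
                             (∑-distrib-+ (λ u → ∑[ v < n ] f u v) (λ u → ∑[ v < n ] g u v))
    forward backward E : Fin n → Fin n → ℕ
    forward  u v = 𝟙 (eqF a u ∧ eqF b v)
    backward u v = 𝟙 (eqF a v ∧ eqF b u)
    E        u v = 𝟙 (edgeAdj T u v)
    forward-once : ∑∑ forward ≡ 1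
    forward-once = trans (sum-cong-≗ λ u → sum-cong-≗ λ v → 𝟙-∧ (eqF a u) (eqF b v)) (∑∑-δ a b)
    backward-once : ∑∑ backward ≡ 1
    backward-once = trans (sum-cong-≗ λ u → sum-cong-≗ λ v → trans (𝟙-∧ (eqF a v) (eqF b u)) (*-comm (𝟙 (eqF a v)) _))
                          (∑∑-δ b a)
    new-cells : ∀ u v → forward u v + backward u v + E u v ≤ 𝟙 (edgeAdj ((a , b) ∷ T) u v)
    new-cells u v = 𝟙-∨-disjoint (eqF a u ∧ eqF b v) (eqF a v ∧ eqF b u) (edgeAdj T u v) forward-new backward-new not-both
      where
      forward-new : (eqF a u ∧ eqF b v) ≡ true → edgeAdj T u v ≡ false
      forward-new e with ∧-≡-true e
      ... | a=u , b=v = subst₂ (λ x y → edgeAdj T x y ≡ false) (eqF⇒≡ a u a=u) (eqF⇒≡ b v b=v) (⊆edges⇒new ⊆E)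
      backward-new : (eqF a v ∧ eqF b u) ≡ true → edgeAdj T u v ≡ false
      backward-new e with ∧-≡-true e
      ... | a=v , b=u = subst₂ (λ x y → edgeAdj T x y ≡ false) (eqF⇒≡ b u b=u) (eqF⇒≡ a v a=v)
                               (trans (edgeAdj-sym T b a) (⊆edges⇒new ⊆E))
      not-both : ((eqF a u ∧ eqF b v) ∧ (eqF a v ∧ eqF b u)) ≡ false
      not-both = ¬-not λ e → ⊆edges⇒loopless ⊆E (eqF-both⇒≡ (proj₁ (∧-≡-true (proj₁ (∧-≡-true {eqF a u ∧ eqF b v} e))) ,
                                                             proj₂ (∧-≡-true {eqF a v} (proj₂ (∧-≡-true {eqF a u ∧ eqF b v} e)))))

  spanningTree⇒length≤n : ∀ {T} → T ∈ subsets (edges G) → isSpanningTree n T ≡ true → length T ≤ n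
  spanningTree⇒length≤n {T} T∈ tree = *-cancelˡ-≤ 2 (≤-trans (2*length≤∑∑edgeAdj T⊆E)
    (acyclic⇒∑∑≤2n (edgeAdj T) (edgeAdj-sym T) (⊆edges⇒irrefl T⊆E) (not-injective (proj₂ (∧-≡-true tree)))))
    where
    T⊆E = ∈-subsets⇒⊆ (edges G) T∈

  τ≤countSubsets≤ : τ G ≤ countSubsets≤ n (edges G)
  τ≤countSubsets≤ = count-mono-∈ (subsets (edges G)) λ T∈ tree → Equivalence.to T-≡ (≤⇒≤ᵇ (spanningTree⇒length≤n T∈ tree))

  τ*n^n≤4^n*[e+n]^n : τ G * n ^ n ≤ 4 ^ n * (length (edges G) + n) ^ n
  τ*n^n≤4^n*[e+n]^n = begin
    τ G * n ^ n                                ≤⟨ *-monoʳ-≤ (τ G) (n^n≤4^n*n! n) ⟩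
    τ G * (4 ^ n * n !)                        ≡⟨ x∙yz≈y∙xz (τ G) (4 ^ n) (n !) ⟩
    4 ^ n * (τ G * n !)                        ≡⟨ cong (4 ^ n *_) (*-comm (τ G) (n !)) ⟩
    4 ^ n * (n ! * τ G)                        ≤⟨ *-monoʳ-≤ (4 ^ n) (*-monoʳ-≤ (n !) τ≤countSubsets≤) ⟩
    4 ^ n * (n ! * countSubsets≤ n (edges G))  ≤⟨ *-monoʳ-≤ (4 ^ n) (k!*countSubsets≤ (edges G) n) ⟩
    4 ^ n * (length (edges G) + n) ^ n         ∎
    where open ≤-Reasoning

  K2Free⇒τ²≤n^n*Kₜ^n : ∀ {t} → K2Free t G → τ G * τ G ≤ n ^ n * Kₜ t ^ n
  K2Free⇒τ²≤n^n*Kₜ^n {t} free = *-cancelʳ-≤ (τ G * τ G) (n ^ n * K ^ n) (N * N) {{>-nonZero (*-mono-< (n^n>0 n) (n^n>0 n))}} (begin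
    τ G * τ G * (N * N)                          ≡⟨ [m*n]*[o*p]≡[m*o]*[n*p] (τ G) (τ G) N N ⟩
    (τ G * N) * (τ G * N)                        ≤⟨ *-mono-≤ τ*n^n≤4^n*[e+n]^n τ*n^n≤4^n*[e+n]^n ⟩
    (4 ^ n * M ^ n) * (4 ^ n * M ^ n)            ≡⟨ [m*n]*[o*p]≡[m*o]*[n*p] (4 ^ n) (M ^ n) (4 ^ n) (M ^ n) ⟩
    (4 ^ n * 4 ^ n) * (M ^ n * M ^ n)            ≡⟨ cong₂ _*_ (^-distribʳ-* 4 4 n) (^-distribʳ-* M M n) ⟨
    16 ^ n * (M * M) ^ n                         ≤⟨ *-monoʳ-≤ (16 ^ n) (^-monoˡ-≤ n (K2Free⇒[e+n]²≤[2t+4]n³ G free)) ⟩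
    16 ^ n * (D * (n * (n * n))) ^ n             ≡⟨ cong (16 ^ n *_) (^-distribʳ-* D (n * (n * n)) n) ⟩
    16 ^ n * (D ^ n * (n * (n * n)) ^ n)         ≡⟨ cong (λ x → 16 ^ n * (D ^ n * x)) cube ⟩
    16 ^ n * (D ^ n * (N * (N * N)))             ≡⟨ regroup (16 ^ n) (D ^ n) N ⟩
    N * (16 ^ n * D ^ n) * (N * N)               ≡⟨ cong (λ x → N * x * (N * N)) (^-distribʳ-* 16 D n) ⟨
    N * K ^ n * (N * N)                          ∎)
    where
    open ≤-Reasoning
    D = 2 * t + 4
    K = Kₜ t
    N = n ^ n
    M = length (edges G) + n
    cube : (n * (n * n)) ^ n ≡ N * (N * N)
    cube = trans (^-distribʳ-* n (n * n) n) (cong (N *_) (^-distribʳ-* n n n))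
    regroup : ∀ a b x → a * (b * (x * (x * x))) ≡ x * (a * b) * (x * x)
    regroup = solve-∀

-- Powers of 1 + C√m

odd : ℕ → ℕ
odd zero    = 1
odd (suc j) = suc (suc (odd j))

1≤odd : ∀ j → 1 ≤ odd j
1≤odd zero    = ≤-refl
1≤odd (suc j) = s≤s z≤n

odd-bracket : ∀ n → 1 ≤ n → Σ[ j ∈ ℕ ] odd j ≤ n × n ≤ suc (odd j)
odd-bracket (suc zero)          _ = 0 , ≤-refl , n≤1+n 1
odd-bracket (suc (suc zero))    _ = 0 , n≤1+n 1 , ≤-refl
odd-bracket (suc (suc (suc n))) _ with odd-bracket (suc n) (s≤s z≤n)
... | j , lower , upper = suc j , s≤s (s≤s lower) , s≤s (s≤s upper)

module _ (m C : ℕ) where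

  integralPart surdPart : ℕ → ℕ
  integralPart k = proj₁ (powS m (1 , C) k)
  surdPart     k = proj₂ (powS m (1 , C) k)

  surdPart-mono : ∀ {k l} → k ≤ l → surdPart k ≤ surdPart l
  surdPart-mono = mono′ ∘ ≤⇒≤′
    where
    mono′ : ∀ {k l} → k ≤′ l → surdPart k ≤ surdPart l
    mono′ ≤′-refl            = ≤-refl
    mono′ (≤′-step {l} k≤′l) = ≤-trans (mono′ k≤′l) (≤-trans (≤-reflexive (sym (*-identityˡ (surdPart l))))
                                                              (m≤m+n (1 * surdPart l) (C * integralPart l)))

  C²m*surd≤surd[2+k] : ∀ k → C * C * m * surdPart k ≤ surdPart (2 + k)
  C²m*surd≤surd[2+k] k = begin
    C * C * m * surdPart k      ≡⟨ identity C m (surdPart k) ⟩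
    C * (C * surdPart k * m)    ≤⟨ *-monoʳ-≤ C (m≤n+m (C * surdPart k * m) (1 * integralPart k)) ⟩
    C * integralPart (suc k)    ≤⟨ m≤n+m (C * integralPart (suc k)) (1 * surdPart (suc k)) ⟩
    surdPart (2 + k)            ∎
    where
    open ≤-Reasoning
    identity : ∀ C m x → C * C * m * x ≡ C * (C * x * m)
    identity = solve-∀

  [C²m]^odd≤surd²m : ∀ j → (C * C * m) ^ odd j ≤ surdPart (odd j) * surdPart (odd j) * m
  [C²m]^odd≤surd²m zero    = ≤-reflexive (identity C m)
    where
    identity : ∀ C m → C * C * m * 1 ≡ (1 * 0 + C * 1) * (1 * 0 + C * 1) * m
    identity = solve-∀
  [C²m]^odd≤surd²m (suc j) = begin
    X * (X * X ^ odd j)                                    ≤⟨ *-monoʳ-≤ X (*-monoʳ-≤ X ([C²m]^odd≤surd²m j)) ⟩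
    X * (X * (surdPart (odd j) * surdPart (odd j) * m))    ≡⟨ identity X (surdPart (odd j)) m ⟩
    X * surdPart (odd j) * (X * surdPart (odd j)) * m      ≤⟨ *-monoˡ-≤ m (*-mono-≤ two-steps two-steps) ⟩
    surdPart (odd (suc j)) * surdPart (odd (suc j)) * m    ∎
    where
    open ≤-Reasoning
    X = C * C * m
    two-steps = C²m*surd≤surd[2+k] (odd j)
    identity : ∀ X y m → X * (X * (y * y * m)) ≡ X * y * (X * y) * m
    identity = solve-∀

n⁴*[n^n*K^n]≤[32K²n]^N : ∀ {n K N} → 1 ≤ n → 1 ≤ K → 1 ≤ N → n ≤ suc N →
                         n ^ 4 * (n ^ n * K ^ n) ≤ (32 * (K * K) * n) ^ N
n⁴*[n^n*K^n]≤[32K²n]^N {n} {K} {N} 1≤n 1≤K 1≤N n≤1+N = begin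
  n ^ 4 * (n ^ n * K ^ n)                 ≤⟨ *-monoʳ-≤ (n ^ 4) (*-mono-≤ (^-monoʳ-≤ n {{>-nonZero 1≤n}} n≤1+N)
                                                                       (^-monoʳ-≤ K {{>-nonZero 1≤K}} n≤1+N)) ⟩
  n ^ 4 * (n ^ suc N * K ^ suc N)         ≡⟨ identity n (n ^ 4) K (n ^ N) (K ^ N) ⟩
  n ^ 5 * K * (n ^ N * K ^ N)             ≤⟨ *-monoˡ-≤ (n ^ N * K ^ N) (*-mono-≤ (n^5≤32^N {N = N} (≤-trans n≤1+N (1+n≤2^n N 1≤N)))
                                                                                 (K≤K^N N 1≤N)) ⟩
  32 ^ N * K ^ N * (n ^ N * K ^ N)        ≡⟨ regroup (32 ^ N) (K ^ N) (n ^ N) ⟩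
  32 ^ N * (K ^ N * K ^ N) * n ^ N        ≡⟨ cong (λ x → 32 ^ N * x * n ^ N) (^-distribʳ-* K K N) ⟨
  32 ^ N * (K * K) ^ N * n ^ N            ≡⟨ cong (_* n ^ N) (^-distribʳ-* 32 (K * K) N) ⟨
  (32 * (K * K)) ^ N * n ^ N              ≡⟨ ^-distribʳ-* (32 * (K * K)) n N ⟨
  (32 * (K * K) * n) ^ N                  ∎
  where
  open ≤-Reasoning
  identity : ∀ n n⁴ K p q → n⁴ * (n * p * (K * q)) ≡ n * n⁴ * K * (p * q)
  identity = solve-∀
  regroup : ∀ a k p → a * k * (p * k) ≡ a * (k * k) * p
  regroup = solve-∀
  K≤K^N : ∀ N → 1 ≤ N → K ≤ K ^ N
  K≤K^N (suc N) _ = subst (_≤ K * K ^ N) (*-identityʳ K) (*-monoʳ-≤ K (subst (_≤ K ^ N) (^-zeroˡ N) (^-monoˡ-≤ N 1≤K)))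

-- Any C with 32 Kₜ² ≤ C² would do.
Cₜ : ℕ → ℕ
Cₜ t = 6 * Kₜ t

32Kₜ²≤Cₜ² : ∀ t → 32 * (Kₜ t * Kₜ t) ≤ Cₜ t * Cₜ t
32Kₜ²≤Cₜ² t = subst (32 * (Kₜ t * Kₜ t) ≤_) (six-squared (Kₜ t)) (*-monoˡ-≤ (Kₜ t * Kₜ t) (m≤m+n 32 4))
  where
  six-squared : ∀ K → 36 * (K * K) ≡ 6 * K * (6 * K)
  six-squared = solve-∀

K2Free⇒n²τ≤[1+Cₜ√n]^n : ∀ {n t} (G : Graph n) → K2Free t G → 1 ≤ n → (n * n * τ G) ≤[√ n ] powS n (1 , Cₜ t) n
K2Free⇒n²τ≤[1+Cₜ√n]^n {n} {t} G free 1≤n with odd-bracket n 1≤n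
... | j , N≤n , n≤1+N = inj₂ (begin
  (x ∸ integralPart n C n) * (x ∸ integralPart n C n)   ≤⟨ *-mono-≤ x∸a≤x x∸a≤x ⟩
  x * x                                                 ≡⟨ identity n (τ G) ⟩
  n ^ 4 * (τ G * τ G)                                   ≤⟨ *-monoʳ-≤ (n ^ 4) (K2Free⇒τ²≤n^n*Kₜ^n G free) ⟩
  n ^ 4 * (n ^ n * K ^ n)                               ≤⟨ n⁴*[n^n*K^n]≤[32K²n]^N 1≤n (1≤Kₜ t) (1≤odd j) n≤1+N ⟩
  (32 * (K * K) * n) ^ N                                ≤⟨ ^-monoˡ-≤ N (*-monoˡ-≤ n (32Kₜ²≤Cₜ² t)) ⟩
  (C * C * n) ^ N                                       ≤⟨ [C²m]^odd≤surd²m n C j ⟩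
  surdPart n C N * surdPart n C N * n                   ≤⟨ *-monoˡ-≤ n (*-mono-≤ (surdPart-mono n C N≤n) (surdPart-mono n C N≤n)) ⟩
  surdPart n C n * surdPart n C n * n                   ∎)
  where
  open ≤-Reasoning
  K = Kₜ t
  C = Cₜ t
  N = odd j
  x = n * n * τ G
  x∸a≤x = m∸n≤m x (integralPart n C n)
  identity : ∀ n τ → n * n * τ * (n * n * τ) ≡ n * (n * (n * (n * 1))) * (τ * τ)
  identity = solve-∀

proposition6p1 : (t : ℕ) → 2 ≤ t →
    (Σ ℕ λ C → 1 ≤ C × ((n : ℕ) → 1 ≤ n → (G : Graph n) → K2Free t G →
        (n * n * τ G) ≤[√ n ] powS n (1 , C) n))
    ×
    (Σ ℕ λ K → ((n : ℕ) → 1 ≤ n → (G : Graph n) → Connected G → K2Free t G →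
        τ G * τ G ≤ n ^ n * K ^ n))
proposition6p1 t _ =
  (Cₜ t , ≤-trans (1≤Kₜ t) (m≤n*m (Kₜ t) 6) , λ n 1≤n G free → K2Free⇒n²τ≤[1+Cₜ√n]^n G free 1≤n) ,
  (Kₜ t , λ n _ G _ free → K2Free⇒τ²≤n^n*Kₜ^n G free)
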